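{- Let $G=(V,E)$ and $G'=(V',E')$ be finite undirected multigraphs (loops allowed), and let $(\gamma,\lambda)\colon G\to G'$ be a graph morphism. Let $\lambda^*\colon \Phi_{G'}\to\Phi_G$ be the algebra homomorphism defined on generators by $\lambda^*(\phi_{e'})=\sum_{e\in\lambda^{ -1}(e')}\phi_e$ (so $\lambda^*(\phi_{\lambda(e)})=\phi_e$ and $\lambda^*(\phi_{e'})=0$ if $e'\notin\lambda(E)$). Then $\lambda^*(\mathcal{C}_{G'})\subseteq \mathcal{C}_G$.
   Context: All algebras are commutative unital over a field $\mathbb{K}$ of characteristic $0$. A graph morphism $(\gamma,\lambda)\colon (V,E)\to(V',E')$ is a pair of maps $\gamma\colon V\to V'$, $\lambda\colon E\to E'$, with $\lambda$ injective, preserving incidences: if $e\in E$ joins $u$ and $v$, then $\lambda(e)$ joins $\gamma(u)$ and $\gamma(v)$. The edge algebra is $\Phi_G=\mathbb{K}[\phi_e : e\in E]/(\phi_e^2 : e\in E)$. Fix a linear order $<$ on $V$. For $v\in V$ set $X_v=\sum_{e\in E}c_{v,e}\phi_e$, where $c_{v,e}=1$ if $e=\{v,u\}$ with $v<u$, $c_{v,e}=-1$ if $e=\{v,u\}$ with $v>u$, and $c_{v,e}=0$ otherwise (in particular loops contribute nothing). The zonotopal algebra $\mathcal{C}_G$ is the subalgebra of $\Phi_G$ generated by the $X_v$, $v\in V$. The linear orders on $V$ and $V'$ used to define $\mathcal{C}_G$ and $\mathcal{C}_{G'}$ are chosen compatibly, i.e. so that $\gamma$ is monotone. -}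

module Defs where

open import Level using (Level; _⊔_) renaming (suc to lsuc)
open import Algebra.Bundles using (CommutativeRing)
open import Data.Nat as ℕ using (ℕ; zero; suc)
open import Data.Fin using (Fin; zero; suc; _<_; _≤_)
open import Data.Fin.Properties using (_≟_; _<?_)
open import Data.Product using (_×_; _,_; ∃)
open import Data.Sum using (_⊎_)
open import Data.Unit.Polymorphic using (⊤)
open import Relation.Nullary using (¬_; yes; no)
open import Relation.Binary.PropositionalEquality using (_≡_)
open import Function.Definitions using (Injective)

module _ {c ℓ : Level} (K : CommutativeRing c ℓ) where
  open CommutativeRing K

  IsField : Set (c ⊔ ℓ)
  IsField = (¬ (1# ≈ 0#)) × (∀ x → ¬ (x ≈ 0#) → ∃ λ y → (x * y) ≈ 1#)

  natK : ℕ → Carrier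
  natK zero    = 0#
  natK (suc n) = 1# + natK n

  CharZero : Set ℓ
  CharZero = ∀ n → ¬ (natK (suc n) ≈ 0#)

-- Vertices Fin n (linear order: the standard order on Fin n),
-- edges Fin m; edge e joins (end₁ e) and (end₂ e); the order of the two
-- ends carries no meaning (see the morphism condition below).

record Graph : Set where
  field
    nV   : ℕ
    nE   : ℕ
    end₁ : Fin nE → Fin nV
    end₂ : Fin nE → Fin nV
open Graph public

Joins : (G : Graph) → Fin (nE G) → Fin (nV G) → Fin (nV G) → Set
Joins G e u v = (end₁ G e ≡ u × end₂ G e ≡ v) ⊎ (end₁ G e ≡ v × end₂ G e ≡ u)

-- graph morphism (γ, λ), λ injective, incidence preserving; the vertex
-- orders are compatible, i.e. γ is monotone
record Morphism (G G' : Graph) : Set where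
  field
    γ        : Fin (nV G) → Fin (nV G')
    λ'       : Fin (nE G) → Fin (nE G')
    λ-inj    : Injective _≡_ _≡_ λ'
    incident : ∀ e u v → Joins G e u v → Joins G' (λ' e) (γ u) (γ v)
    γ-mono   : ∀ u v → u ≤ v → γ u ≤ γ v
open Morphism public

-- The edge algebra Φ_m = K[φ_0,…,φ_{m-1}]/(φ_i²), built iteratively:
-- Φ_0 = K and Φ_{m+1} = Φ_m[φ]/(φ²), an element (a , b) meaning a + b·φ
-- where φ = φ_0 is the new generator and φ_{i+1} comes from Φ_m.

module EdgeAlgebra {c ℓ : Level} (K : CommutativeRing c ℓ) where
  private module K = CommutativeRing K
  open K using (Carrier)

  data Φ : ℕ → Set c where
    scal : Carrier → Φ zero
    _⊕φ_ : ∀ {m} → Φ m → Φ m → Φ (suc m)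

  _≈Φ_ : ∀ {m} → Φ m → Φ m → Set ℓ
  _≈Φ_ (scal x) (scal y) = x K.≈ y
  _≈Φ_ (a ⊕φ b) (a' ⊕φ b') = (a ≈Φ a') × (b ≈Φ b')

  const : ∀ {m} → Carrier → Φ m
  const {zero}  k = scal k
  const {suc m} k = const k ⊕φ const K.0#

  0Φ 1Φ : ∀ {m} → Φ m
  0Φ = const K.0#
  1Φ = const K.1#

  _+Φ_ : ∀ {m} → Φ m → Φ m → Φ m
  scal x +Φ scal y = scal (x K.+ y)
  (a ⊕φ b) +Φ (a' ⊕φ b') = (a +Φ a') ⊕φ (b +Φ b')

  -- (a + bφ)(a' + b'φ) = aa' + (ab' + ba')φ   since φ² = 0
  _*Φ_ : ∀ {m} → Φ m → Φ m → Φ m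
  scal x *Φ scal y = scal (x K.* y)
  (a ⊕φ b) *Φ (a' ⊕φ b') = (a *Φ a') ⊕φ ((a *Φ b') +Φ (b *Φ a'))

  _·Φ_ : ∀ {m} → Carrier → Φ m → Φ m
  k ·Φ x = const k *Φ x

  φ : ∀ {m} → Fin m → Φ m
  φ {suc m} zero    = 0Φ ⊕φ 1Φ
  φ {suc m} (suc i) = φ i ⊕φ 0Φ

  ΣΦ : ∀ {m} (k : ℕ) → (Fin k → Φ m) → Φ m
  ΣΦ zero    f = 0Φ
  ΣΦ (suc k) f = f zero +Φ ΣΦ k (λ i → f (suc i))

  record IsAlgHom {m' m : ℕ} (h : Φ m' → Φ m) : Set (c ⊔ ℓ) where
    field
      resp  : ∀ {x y} → x ≈Φ y → h x ≈Φ h y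
      const-hom : ∀ k → h (const k) ≈Φ const k
      +-hom : ∀ x y → h (x +Φ y) ≈Φ (h x +Φ h y)
      *-hom : ∀ x y → h (x *Φ y) ≈Φ (h x *Φ h y)

  coeff : (G : Graph) → Fin (nV G) → Fin (nE G) → Carrier
  coeff G v e with end₁ G e ≟ end₂ G e
  ... | yes _ = K.0#
  ... | no _ with v ≟ end₁ G e | v ≟ end₂ G e
  ...   | yes _ | _ with v <? end₂ G e
  ...     | yes _ = K.1#
  ...     | no _  = K.- K.1#
  coeff G v e | no _ | no _ | yes _ with v <? end₁ G e
  ...     | yes _ = K.1#
  ...     | no _  = K.- K.1#
  coeff G v e | no _ | no _ | no _ = K.0#

  X : (G : Graph) → Fin (nV G) → Φ (nE G)
  X G v = ΣΦ (nE G) (λ e → coeff G v e ·Φ φ e)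

  data InC (G : Graph) : Φ (nE G) → Set (c ⊔ ℓ) where
    gen   : ∀ v → InC G (X G v)
    scalar : ∀ k → InC G (const k)
    plus  : ∀ {x y} → InC G x → InC G y → InC G (x +Φ y)
    times : ∀ {x y} → InC G x → InC G y → InC G (x *Φ y)
    resp  : ∀ {x y} → x ≈Φ y → InC G x → InC G y

  pullbackGen : {G G' : Graph} → Morphism G G' → Fin (nE G') → Φ (nE G)
  pullbackGen {G} f e' = ΣΦ (nE G) (λ e → pick e)
    where
      pick : Fin (nE G) → Φ (nE G)
      pick e with λ' f e ≟ e'
      ... | yes _ = φ e
      ... | no _  = 0Φ

-- λ* is a ring homomorphism, so it suffices to show that it maps each generator X_v' into 𝒞_G.
-- Comparing coefficients of φ_e shows λ*(X_v') = Σ_{γ v = v'} X_v: writing c_{v,e} as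
-- sgn(u,w)·[v = u] + sgn(w,u)·[v = w] for e = {u,w}, the sum over the fibre of v' picks out
-- sgn(u,w)·[γu = v'] + sgn(w,u)·[γw = v'].  Since γ is monotone, sgn(γu,γw) = sgn(u,w) when
-- γu ≠ γw, and when γu = γw both sides vanish: λ(e) is then a loop, and the two signs cancel.
module Submission where

open import Defs
open import Level using (Level)
open import Algebra.Bundles using (CommutativeRing)
open import Data.Nat using (zero; suc)
import Data.Nat.Properties as ℕ
open import Data.Fin using (Fin; zero; suc; _<_; _≤_)
open import Data.Fin.Properties using (_≟_; _<?_; <-cmp; ≤∧≢⇒<)
open import Data.Vec using (Vec; []; _∷_)
open import Data.Bool using (Bool; true; false)
open import Data.Product using (_,_)
open import Data.Sum using (inj₁; inj₂)
open import Data.Empty using (⊥-elim)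
open import Function using (_∘_)
open import Relation.Nullary using (¬_; yes; no)
open import Relation.Binary.Definitions using (tri<; tri≈; tri>)
open import Relation.Binary.PropositionalEquality as ≡ using (_≡_; _≢_)

module _ {c ℓ : Level} (K : CommutativeRing c ℓ) where
  open CommutativeRing K hiding (zero)
  open EdgeAlgebra K
  open import Algebra.Properties.Semiring.Sum semiring
  open import Relation.Binary.Reasoning.Setoid setoid

  δ : ∀ {n} → Fin n → Fin n → Carrier
  δ zero    zero    = 1#
  δ zero    (suc _) = 0#
  δ (suc _) zero    = 0#
  δ (suc i) (suc j) = δ i j

  δ-≡ : ∀ {n} {i j : Fin n} → i ≡ j → δ i j ≈ 1#
  δ-≡ {i = zero}  ≡.refl = refl
  δ-≡ {i = suc i} ≡.refl = δ-≡ {i = i} ≡.refl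

  δ-≢ : ∀ {n} {i j : Fin n} → i ≢ j → δ i j ≈ 0#
  δ-≢ {i = zero}  {zero}  i≢j = ⊥-elim (i≢j ≡.refl)
  δ-≢ {i = zero}  {suc _} _   = refl
  δ-≢ {i = suc _} {zero}  _   = refl
  δ-≢ {i = suc _} {suc _} i≢j = δ-≢ (i≢j ∘ ≡.cong suc)

  ∑-δ : ∀ {n} (g : Fin n → Carrier) (j : Fin n) → ∑[ i < n ] (g i * δ j i) ≈ g j
  ∑-δ {suc n} g zero = begin
    g zero * 1# + ∑[ i < n ] (g (suc i) * 0#) ≈⟨ +-cong (*-identityʳ _) (sum-cong-≋ {n} (λ i → zeroʳ _)) ⟩
    g zero + ∑[ i < n ] 0#                    ≈⟨ +-congˡ (sum-replicate-zero n) ⟩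
    g zero + 0#                               ≈⟨ +-identityʳ _ ⟩
    g zero                                    ∎
  ∑-δ {suc n} g (suc j) = trans (+-cong (zeroʳ _) (∑-δ (g ∘ suc) j)) (+-identityˡ _)

  ∑-*-∑ : ∀ {m n} (a : Fin m → Carrier) (b : Fin m → Fin n → Carrier) (x : Fin n → Carrier) →
          ∑[ i < m ] (a i * ∑[ j < n ] (b i j * x j)) ≈ ∑[ j < n ] (∑[ i < m ] (a i * b i j) * x j)
  ∑-*-∑ {m} {n} a b x = begin
    ∑[ i < m ] (a i * ∑[ j < n ] (b i j * x j))   ≈⟨ sum-cong-≋ {m} (λ i → *-distribˡ-sum (a i) (λ j → b i j * x j)) ⟩
    ∑[ i < m ] ∑[ j < n ] (a i * (b i j * x j))   ≈⟨ ∑-comm (λ i j → a i * (b i j * x j)) ⟩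
    ∑[ j < n ] ∑[ i < m ] (a i * (b i j * x j))   ≈⟨ sum-cong-≋ {n} (λ j → sum-cong-≋ {m} (λ i → sym (*-assoc _ _ _))) ⟩
    ∑[ j < n ] ∑[ i < m ] (a i * b i j * x j)     ≈⟨ sum-cong-≋ {n} (λ j → sym (*-distribʳ-sum (x j) (λ i → a i * b i j))) ⟩
    ∑[ j < n ] (∑[ i < m ] (a i * b i j) * x j)   ∎

  sgn : ∀ {n} → Fin n → Fin n → Carrier
  sgn u w with <-cmp u w
  ... | tri< _ _ _ = 1#
  ... | tri≈ _ _ _ = 0#
  ... | tri> _ _ _ = - 1#

  sgn-< : ∀ {n} {u w : Fin n} → u < w → sgn u w ≈ 1#
  sgn-< {u = u} {w} u<w with <-cmp u w
  ... | tri< _ _ _   = refl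
  ... | tri≈ u≮w _ _ = ⊥-elim (u≮w u<w)
  ... | tri> u≮w _ _ = ⊥-elim (u≮w u<w)

  sgn-> : ∀ {n} {u w : Fin n} → w < u → sgn u w ≈ - 1#
  sgn-> {u = u} {w} w<u with <-cmp u w
  ... | tri< _ _ w≮u = ⊥-elim (w≮u w<u)
  ... | tri≈ _ _ w≮u = ⊥-elim (w≮u w<u)
  ... | tri> _ _ _   = refl

  sgn-refl : ∀ {n} (u : Fin n) → sgn u u ≈ 0#
  sgn-refl u with <-cmp u u
  ... | tri< _ u≢u _ = ⊥-elim (u≢u ≡.refl)
  ... | tri≈ _ _ _   = refl
  ... | tri> _ u≢u _ = ⊥-elim (u≢u ≡.refl)

  sgn-≮ : ∀ {n} {u w : Fin n} → u ≢ w → ¬ u < w → sgn u w ≈ - 1#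
  sgn-≮ u≢w u≮w = sgn-> (≤∧≢⇒< (ℕ.≮⇒≥ u≮w) (u≢w ∘ ≡.sym))

  sgn-antisym : ∀ {n} (u w : Fin n) → sgn u w + sgn w u ≈ 0#
  sgn-antisym u w with <-cmp u w
  ... | tri< u<w _ _    = trans (+-congˡ (sgn-> u<w)) (-‿inverseʳ 1#)
  ... | tri≈ _ ≡.refl _ = trans (+-congˡ (sgn-refl u)) (+-identityʳ 0#)
  ... | tri> _ _ w<u    = trans (+-congˡ (sgn-< w<u)) (-‿inverseˡ 1#)

  sgn-monotone : ∀ {n n'} (γ : Fin n → Fin n') → (∀ u v → u ≤ v → γ u ≤ γ v) →
                 ∀ {u w} → γ u ≢ γ w → sgn (γ u) (γ w) ≈ sgn u w
  sgn-monotone γ mono {u} {w} γu≢γw with <-cmp u w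
  ... | tri< u<w _ _ = sgn-< (≤∧≢⇒< (mono u w (ℕ.<⇒≤ u<w)) γu≢γw)
  ... | tri≈ _ u≡w _ = ⊥-elim (γu≢γw (≡.cong γ u≡w))
  ... | tri> _ _ w<u = sgn-> (≤∧≢⇒< (mono w u (ℕ.<⇒≤ w<u)) (γu≢γw ∘ ≡.sym))

  incidence : ∀ {n} → Fin n → Fin n → Fin n → Carrier
  incidence u w v = sgn u w * δ u v + sgn w u * δ w v

  incidence-comm : ∀ {n} (u w v : Fin n) → incidence u w v ≈ incidence w u v
  incidence-comm u w v = +-comm _ _

  incidence-loop : ∀ {n} {u w : Fin n} (v : Fin n) → u ≡ w → incidence u w v ≈ 0#
  incidence-loop {u = u} v ≡.refl = begin
    sgn u u * δ u v + sgn u u * δ u v ≈⟨ +-cong (*-congʳ (sgn-refl u)) (*-congʳ (sgn-refl u)) ⟩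
    0# * δ u v + 0# * δ u v           ≈⟨ +-cong (zeroˡ _) (zeroˡ _) ⟩
    0# + 0#                           ≈⟨ +-identityʳ 0# ⟩
    0#                                ∎

  incidence-source : ∀ {n} {u w v : Fin n} → v ≡ u → u ≢ w → incidence u w v ≈ sgn u w
  incidence-source {u = u} {w} ≡.refl u≢w = begin
    sgn u w * δ u u + sgn w u * δ w u ≈⟨ +-cong (*-congˡ (δ-≡ {i = u} ≡.refl)) (*-congˡ (δ-≢ (u≢w ∘ ≡.sym))) ⟩
    sgn u w * 1# + sgn w u * 0#       ≈⟨ +-cong (*-identityʳ _) (zeroʳ _) ⟩
    sgn u w + 0#                      ≈⟨ +-identityʳ _ ⟩
    sgn u w                           ∎

  incidence-target : ∀ {n} {u w v : Fin n} → v ≡ w → u ≢ w → incidence u w v ≈ sgn w u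
  incidence-target {u = u} {w} {v} v≡w u≢w =
    trans (incidence-comm u w v) (incidence-source v≡w (u≢w ∘ ≡.sym))

  incidence-off : ∀ {n} {u w v : Fin n} → v ≢ u → v ≢ w → incidence u w v ≈ 0#
  incidence-off {u = u} {w} {v} v≢u v≢w = begin
    sgn u w * δ u v + sgn w u * δ w v ≈⟨ +-cong (*-congˡ (δ-≢ (v≢u ∘ ≡.sym))) (*-congˡ (δ-≢ (v≢w ∘ ≡.sym))) ⟩
    sgn u w * 0# + sgn w u * 0#       ≈⟨ +-cong (zeroʳ _) (zeroʳ _) ⟩
    0# + 0#                           ≈⟨ +-identityʳ 0# ⟩
    0#                                ∎

  ∑-*-incidence : ∀ {n} (g : Fin n → Carrier) (u w : Fin n) →
                  ∑[ v < n ] (g v * incidence u w v) ≈ g u * sgn u w + g w * sgn w u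
  ∑-*-incidence {n} g u w = begin
    ∑[ v < n ] (g v * incidence u w v)
      ≈⟨ sum-cong-≋ {n} (λ v → trans (distribˡ _ _ _) (+-cong (sym (*-assoc _ _ _)) (sym (*-assoc _ _ _)))) ⟩
    ∑[ v < n ] (g v * sgn u w * δ u v + g v * sgn w u * δ w v)
      ≈⟨ ∑-distrib-+ (λ v → g v * sgn u w * δ u v) (λ v → g v * sgn w u * δ w v) ⟩
    ∑[ v < n ] (g v * sgn u w * δ u v) + ∑[ v < n ] (g v * sgn w u * δ w v)
      ≈⟨ +-cong (∑-δ _ u) (∑-δ _ w) ⟩
    g u * sgn u w + g w * sgn w u
      ∎

  incidence-pushforward : ∀ {n n'} (γ : Fin n → Fin n') → (∀ u v → u ≤ v → γ u ≤ γ v) →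
    ∀ u w v' → ∑[ v < n ] (δ (γ v) v' * incidence u w v) ≈ incidence (γ u) (γ w) v'
  incidence-pushforward {n} γ mono u w v' with γ u ≟ γ w
  ... | yes γu≡γw = begin
    ∑[ v < n ] (δ (γ v) v' * incidence u w v)    ≈⟨ ∑-*-incidence _ u w ⟩
    δ (γ u) v' * sgn u w + δ (γ w) v' * sgn w u  ≈⟨ +-congˡ (*-congʳ (reflexive (≡.cong (λ x → δ x v') (≡.sym γu≡γw)))) ⟩
    δ (γ u) v' * sgn u w + δ (γ u) v' * sgn w u  ≈⟨ sym (distribˡ _ _ _) ⟩
    δ (γ u) v' * (sgn u w + sgn w u)             ≈⟨ *-congˡ (sgn-antisym u w) ⟩
    δ (γ u) v' * 0#                              ≈⟨ zeroʳ _ ⟩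
    0#                                           ≈⟨ sym (incidence-loop v' γu≡γw) ⟩
    incidence (γ u) (γ w) v'                     ∎
  ... | no γu≢γw = begin
    ∑[ v < n ] (δ (γ v) v' * incidence u w v)    ≈⟨ ∑-*-incidence _ u w ⟩
    δ (γ u) v' * sgn u w + δ (γ w) v' * sgn w u  ≈⟨ +-cong (*-comm _ _) (*-comm _ _) ⟩
    sgn u w * δ (γ u) v' + sgn w u * δ (γ w) v'  ≈⟨ +-cong (*-congʳ (sym (sgn-monotone γ mono γu≢γw)))
                                                          (*-congʳ (sym (sgn-monotone γ mono (γu≢γw ∘ ≡.sym)))) ⟩
    incidence (γ u) (γ w) v'                     ∎

  coeff-incidence : ∀ G v e → coeff G v e ≈ incidence (end₁ G e) (end₂ G e) v
  coeff-incidence G v e with end₁ G e ≟ end₂ G e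
  ... | yes u≡w = sym (incidence-loop v u≡w)
  ... | no u≢w with v ≟ end₁ G e | v ≟ end₂ G e
  ...   | yes v≡u | _ with v <? end₂ G e
  ...     | yes v<w = sym (trans (incidence-source v≡u u≢w) (sgn-< (≡.subst (_< end₂ G e) v≡u v<w)))
  ...     | no v≮w  = sym (trans (incidence-source v≡u u≢w) (sgn-≮ u≢w (v≮w ∘ ≡.subst (_< end₂ G e) (≡.sym v≡u))))
  coeff-incidence G v e | no u≢w | no _ | yes v≡w with v <? end₁ G e
  ...     | yes v<u = sym (trans (incidence-target v≡w u≢w) (sgn-< (≡.subst (_< end₁ G e) v≡w v<u)))
  ...     | no v≮u  = sym (trans (incidence-target v≡w u≢w)
                                 (sgn-≮ (u≢w ∘ ≡.sym) (v≮u ∘ ≡.subst (_< end₁ G e) (≡.sym v≡w))))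
  coeff-incidence G v e | no _ | no v≢u | no v≢w = sym (incidence-off v≢u v≢w)

  coeff-pushforward : ∀ {G G'} (f : Morphism G G') v' e →
    ∑[ v < nV G ] (δ (γ f v) v' * coeff G v e) ≈ coeff G' v' (λ' f e)
  coeff-pushforward {G} {G'} f v' e = begin
    ∑[ v < nV G ] (δ (γ f v) v' * coeff G v e)          ≈⟨ sum-cong-≋ {nV G} (λ v → *-congˡ (coeff-incidence G v e)) ⟩
    ∑[ v < nV G ] (δ (γ f v) v' * incidence u w v)      ≈⟨ incidence-pushforward (γ f) (γ-mono f) u w v' ⟩
    incidence (γ f u) (γ f w) v'                        ≈⟨ image (incident f e u w (inj₁ (≡.refl , ≡.refl))) ⟩
    incidence (end₁ G' (λ' f e)) (end₂ G' (λ' f e)) v'  ≈⟨ sym (coeff-incidence G' v' (λ' f e)) ⟩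
    coeff G' v' (λ' f e)                                ∎
    where
    u w : Fin (nV G)
    u = end₁ G e
    w = end₂ G e
    image : Joins G' (λ' f e) (γ f u) (γ f w) →
            incidence (γ f u) (γ f w) v' ≈ incidence (end₁ G' (λ' f e)) (end₂ G' (λ' f e)) v'
    image (inj₁ (p , q)) = reflexive (≡.cong₂ (λ a b → incidence a b v') (≡.sym p) (≡.sym q))
    image (inj₂ (p , q)) = trans (incidence-comm (γ f u) (γ f w) v')
                                 (reflexive (≡.cong₂ (λ a b → incidence a b v') (≡.sym p) (≡.sym q)))

  -- coord x s is the coefficient in x of the monomial ∏ {i ∣ s i} φ_i.
  coord : ∀ {m} → Φ m → Vec Bool m → Carrier
  coord (scal x) []          = x
  coord (a ⊕φ _) (false ∷ s) = coord a s
  coord (_ ⊕φ b) (true ∷ s)  = coord b s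

  coord-cong : ∀ {m} (x y : Φ m) → x ≈Φ y → ∀ s → coord x s ≈ coord y s
  coord-cong (scal _) (scal _)  x≈y        []          = x≈y
  coord-cong (a ⊕φ _) (a' ⊕φ _) (a≈a' , _) (false ∷ s) = coord-cong a a' a≈a' s
  coord-cong (_ ⊕φ b) (_ ⊕φ b') (_ , b≈b') (true ∷ s)  = coord-cong b b' b≈b' s

  coord-ext : ∀ {m} (x y : Φ m) → (∀ s → coord x s ≈ coord y s) → x ≈Φ y
  coord-ext (scal _) (scal _) eq = eq []
  coord-ext (a ⊕φ b) (a' ⊕φ b') eq =
    coord-ext a a' (λ s → eq (false ∷ s)) , coord-ext b b' (λ s → eq (true ∷ s))

  ≈Φ-refl : ∀ {m} (x : Φ m) → x ≈Φ x
  ≈Φ-refl x = coord-ext x x (λ _ → refl)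

  ≈Φ-sym : ∀ {m} (x y : Φ m) → x ≈Φ y → y ≈Φ x
  ≈Φ-sym x y x≈y = coord-ext y x (λ s → sym (coord-cong x y x≈y s))

  coord-0Φ : ∀ {m} (s : Vec Bool m) → coord (0Φ {m}) s ≈ 0#
  coord-0Φ []          = refl
  coord-0Φ (false ∷ s) = coord-0Φ s
  coord-0Φ (true ∷ s)  = coord-0Φ s

  coord-+Φ : ∀ {m} (x y : Φ m) s → coord (x +Φ y) s ≈ coord x s + coord y s
  coord-+Φ (scal _) (scal _) []          = refl
  coord-+Φ (a ⊕φ _) (a' ⊕φ _) (false ∷ s) = coord-+Φ a a' s
  coord-+Φ (_ ⊕φ b) (_ ⊕φ b') (true ∷ s)  = coord-+Φ b b' s

  coord-*Φ-const : ∀ {m} (a : Φ m) {k} → a ≈Φ const k → ∀ x s → coord (a *Φ x) s ≈ k * coord x s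
  coord-*Φ-const (scal _) a≈k (scal _) [] = *-congʳ a≈k
  coord-*Φ-const (a ⊕φ _) (a≈k , _) (x ⊕φ _) (false ∷ s) = coord-*Φ-const a a≈k x s
  coord-*Φ-const (a ⊕φ b) {k} (a≈k , b≈0) (x ⊕φ y) (true ∷ s) = begin
    coord ((a *Φ y) +Φ (b *Φ x)) s       ≈⟨ coord-+Φ (a *Φ y) (b *Φ x) s ⟩
    coord (a *Φ y) s + coord (b *Φ x) s  ≈⟨ +-cong (coord-*Φ-const a a≈k y s) (coord-*Φ-const b b≈0 x s) ⟩
    k * coord y s + 0# * coord x s       ≈⟨ +-congˡ (zeroˡ _) ⟩
    k * coord y s + 0#                   ≈⟨ +-identityʳ _ ⟩
    k * coord y s                        ∎

  coord-·Φ : ∀ {m} k (x : Φ m) s → coord (k ·Φ x) s ≈ k * coord x s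
  coord-·Φ {m} k = coord-*Φ-const (const k) (≈Φ-refl {m} (const k))

  coord-ΣΦ : ∀ {m} n (x : Fin n → Φ m) s → coord (ΣΦ n x) s ≈ ∑[ i < n ] coord (x i) s
  coord-ΣΦ zero    x s = coord-0Φ s
  coord-ΣΦ (suc n) x s =
    trans (coord-+Φ (x zero) (ΣΦ n (x ∘ suc)) s) (+-congˡ (coord-ΣΦ n (x ∘ suc) s))

  coord-ΣΦ-·Φ : ∀ {m} n (a : Fin n → Carrier) (x : Fin n → Φ m) s →
                coord (ΣΦ n (λ i → a i ·Φ x i)) s ≈ ∑[ i < n ] (a i * coord (x i) s)
  coord-ΣΦ-·Φ n a x s = trans (coord-ΣΦ n (λ i → a i ·Φ x i) s) (sum-cong-≋ {n} (λ i → coord-·Φ (a i) (x i) s))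

  -- The summand of pullbackGen is defined in an anonymous where-block; unification recovers it.
  mutual
    pullbackSummand : ∀ {G G'} → Morphism G G' → Fin (nE G') → Fin (nE G) → Φ (nE G)
    pullbackSummand = _

    pullbackGen-≡ : ∀ {G G'} (f : Morphism G G') e' → pullbackGen f e' ≡ ΣΦ (nE G) (pullbackSummand f e')
    pullbackGen-≡ f e' = ≡.refl

  coord-pullbackSummand : ∀ {G G'} (f : Morphism G G') e' e s →
                          coord (pullbackSummand f e' e) s ≈ δ (λ' f e) e' * coord (φ e) s
  coord-pullbackSummand f e' e s with λ' f e ≟ e'
  ... | yes λe≡e' = sym (trans (*-congʳ (δ-≡ λe≡e')) (*-identityˡ _))
  ... | no λe≢e'  = trans (coord-0Φ s) (sym (trans (*-congʳ (δ-≢ λe≢e')) (zeroˡ _)))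

  coord-pullbackGen : ∀ {G G'} (f : Morphism G G') e' s →
                      coord (pullbackGen f e') s ≈ ∑[ e < nE G ] (δ (λ' f e) e' * coord (φ e) s)
  coord-pullbackGen {G} f e' s rewrite pullbackGen-≡ f e' =
    trans (coord-ΣΦ (nE G) (pullbackSummand f e') s) (sum-cong-≋ {nE G} (λ e → coord-pullbackSummand f e' e s))

  InC-ΣΦ : ∀ {G} n (x : Fin n → Φ (nE G)) → (∀ i → InC G (x i)) → InC G (ΣΦ n x)
  InC-ΣΦ zero    x _   = scalar 0#
  InC-ΣΦ (suc n) x x∈C = plus (x∈C zero) (InC-ΣΦ n (x ∘ suc) (x∈C ∘ suc))

  module _ {G G' : Graph} (f : Morphism G G') where

    fibreSum : Fin (nV G') → Φ (nE G)
    fibreSum v' = ΣΦ (nV G) (λ v → δ (γ f v) v' ·Φ X G v)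

    fibreSum∈C : ∀ v' → InC G (fibreSum v')
    fibreSum∈C v' = InC-ΣΦ (nV G) _ (λ v → times (scalar _) (gen v))

    coord-fibreSum : ∀ v' s → coord (fibreSum v') s ≈ ∑[ e < nE G ] (coeff G' v' (λ' f e) * coord (φ e) s)
    coord-fibreSum v' s = begin
      coord (fibreSum v') s
        ≈⟨ coord-ΣΦ-·Φ (nV G) (λ v → δ (γ f v) v') (X G) s ⟩
      ∑[ v < nV G ] (δ (γ f v) v' * coord (X G v) s)
        ≈⟨ sum-cong-≋ {nV G} (λ v → *-congˡ (coord-ΣΦ-·Φ (nE G) (coeff G v) φ s)) ⟩
      ∑[ v < nV G ] (δ (γ f v) v' * ∑[ e < nE G ] (coeff G v e * coord (φ e) s))
        ≈⟨ ∑-*-∑ (λ v → δ (γ f v) v') (coeff G) (λ e → coord (φ e) s) ⟩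
      ∑[ e < nE G ] (∑[ v < nV G ] (δ (γ f v) v' * coeff G v e) * coord (φ e) s)
        ≈⟨ sum-cong-≋ {nE G} (λ e → *-congʳ (coeff-pushforward f v' e)) ⟩
      ∑[ e < nE G ] (coeff G' v' (λ' f e) * coord (φ e) s)
        ∎

    module _ (λ* : Φ (nE G') → Φ (nE G)) (hom : IsAlgHom λ*)
             (λ*-φ : ∀ e' → λ* (φ e') ≈Φ pullbackGen f e') where
      open IsAlgHom hom hiding (resp)

      coord-λ*-·Φ : ∀ k x s → coord (λ* (k ·Φ x)) s ≈ k * coord (λ* x) s
      coord-λ*-·Φ k x s = trans (coord-cong (λ* (k ·Φ x)) (λ* (const k) *Φ λ* x) (*-hom (const k) x) s)
                                (coord-*Φ-const (λ* (const k)) (const-hom k) (λ* x) s)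

      coord-λ*-ΣΦ-·Φ : ∀ n (a : Fin n → Carrier) (x : Fin n → Φ (nE G')) s →
        coord (λ* (ΣΦ n (λ i → a i ·Φ x i))) s ≈ ∑[ i < n ] (a i * coord (λ* (x i)) s)
      coord-λ*-ΣΦ-·Φ zero a x s = trans (coord-cong (λ* 0Φ) 0Φ (const-hom 0#) s) (coord-0Φ s)
      coord-λ*-ΣΦ-·Φ (suc n) a x s = begin
        coord (λ* (head +Φ rest)) s          ≈⟨ coord-cong (λ* (head +Φ rest)) (λ* head +Φ λ* rest) (+-hom head rest) s ⟩
        coord (λ* head +Φ λ* rest) s         ≈⟨ coord-+Φ (λ* head) (λ* rest) s ⟩
        coord (λ* head) s + coord (λ* rest) s
          ≈⟨ +-cong (coord-λ*-·Φ (a zero) (x zero) s) (coord-λ*-ΣΦ-·Φ n (a ∘ suc) (x ∘ suc) s) ⟩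
        a zero * coord (λ* (x zero)) s + ∑[ i < n ] (a (suc i) * coord (λ* (x (suc i))) s) ∎
        where
        head rest : Φ (nE G')
        head = a zero ·Φ x zero
        rest = ΣΦ n (λ i → a (suc i) ·Φ x (suc i))

      coord-λ*-X : ∀ v' s → coord (λ* (X G' v')) s ≈ ∑[ e < nE G ] (coeff G' v' (λ' f e) * coord (φ e) s)
      coord-λ*-X v' s = begin
        coord (λ* (X G' v')) s
          ≈⟨ coord-λ*-ΣΦ-·Φ (nE G') (coeff G' v') φ s ⟩
        ∑[ e' < nE G' ] (coeff G' v' e' * coord (λ* (φ e')) s)
          ≈⟨ sum-cong-≋ {nE G'} (λ e' → *-congˡ (trans (coord-cong (λ* (φ e')) (pullbackGen f e') (λ*-φ e') s)
                                                         (coord-pullbackGen f e' s))) ⟩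
        ∑[ e' < nE G' ] (coeff G' v' e' * ∑[ e < nE G ] (δ (λ' f e) e' * coord (φ e) s))
          ≈⟨ ∑-*-∑ (coeff G' v') (λ e' e → δ (λ' f e) e') (λ e → coord (φ e) s) ⟩
        ∑[ e < nE G ] (∑[ e' < nE G' ] (coeff G' v' e' * δ (λ' f e) e') * coord (φ e) s)
          ≈⟨ sum-cong-≋ {nE G} (λ e → *-congʳ (∑-δ (coeff G' v') (λ' f e))) ⟩
        ∑[ e < nE G ] (coeff G' v' (λ' f e) * coord (φ e) s)
          ∎

      λ*-X : ∀ v' → fibreSum v' ≈Φ λ* (X G' v')
      λ*-X v' = coord-ext (fibreSum v') (λ* (X G' v')) (λ s → trans (coord-fibreSum v' s) (sym (coord-λ*-X v' s)))

      λ*-InC : ∀ x → InC G' x → InC G (λ* x)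
      λ*-InC _ (gen v')   = resp (λ*-X v') (fibreSum∈C v')
      λ*-InC _ (scalar k) = resp (≈Φ-sym (λ* (const k)) (const k) (const-hom k)) (scalar k)
      λ*-InC _ (plus {x} {y} x∈C y∈C) =
        resp (≈Φ-sym (λ* (x +Φ y)) (λ* x +Φ λ* y) (+-hom x y)) (plus (λ*-InC x x∈C) (λ*-InC y y∈C))
      λ*-InC _ (times {x} {y} x∈C y∈C) =
        resp (≈Φ-sym (λ* (x *Φ y)) (λ* x *Φ λ* y) (*-hom x y)) (times (λ*-InC x x∈C) (λ*-InC y y∈C))
      λ*-InC _ (resp x≈y x∈C) = resp (IsAlgHom.resp hom x≈y) (λ*-InC _ x∈C)

proposition2p4 : ∀ {c ℓ : Level} (K : CommutativeRing c ℓ) → IsField K → CharZero K →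
    (G G' : Graph) (f : Morphism G G') →
    (λ* : EdgeAlgebra.Φ K (nE G') → EdgeAlgebra.Φ K (nE G)) →
    EdgeAlgebra.IsAlgHom K λ* →
    (∀ e' → EdgeAlgebra._≈Φ_ K (λ* (EdgeAlgebra.φ K e')) (EdgeAlgebra.pullbackGen K f e')) →
    ∀ x → EdgeAlgebra.InC K G' x → EdgeAlgebra.InC K G (λ* x)
proposition2p4 K _ _ G G' f = λ*-InC K f
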